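{- For all integers $m,n\geq 1$, the $3$-cut complex $\Delta_3\left(H_{1\times m\times n}\right)$ of the hexagonal grid graph $H_{1\times m\times n}$ is shellable.
   Context: The hexagonal grid graph $H_{1\times m\times n}$ is the graph of vertices and edges of a parallelogram-shaped patch of the regular hexagonal (honeycomb) tiling of the plane consisting of $m\times n$ hexagons: in axial coordinates, take the hexagons $(p,q)$ with $p\in\{1,\dots,m\}$, $q\in\{1,\dots,n\}$, where hexagon $(p,q)$ shares an edge with $(p\pm1,q)$, $(p,q\pm1)$, $(p+1,q-1)$, $(p-1,q+1)$; $H_{1\times m\times n}$ has as vertices all corners of these hexagons and as edges all sides of these hexagons. It has $2m+2n+2mn$ vertices, of which $2m+2n$ have degree $2$ and $2mn-2$ have degree $3$. For a graph $G$ and $k\geq 1$, the $k$-cut complex $\Delta_k(G)$ is the simplicial complex on vertex set $V(G)$ whose facets are the sets $\sigma\subseteq V(G)$ such that $|V(G)\setminus\sigma|=k$ and the induced subgraph $G[V(G)\setminus\sigma]$ is disconnected. A (pure) simplicial complex is shellable if its facets can be linearly ordered $F_1,\dots,F_t$ so that for each $2\le j\le t$ the complex $\left(\bigcup_{s<j}\langle F_s\rangle\right)\cap\langle F_j\rangle$ is pure of dimension $\dim F_j-1$ (where $\langle F\rangle$ denotes the simplex on $F$ with all its faces). -}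

module Defs where

open import Data.Bool using (Bool; true; false; not; T; _∧_)
open import Data.Nat using (ℕ; zero; suc; _≤_; _∸_; _≤ᵇ_)
open import Data.Fin using (Fin; toℕ)
open import Data.Product using (Σ; Σ-syntax; _×_; _,_; proj₁)
open import Data.List using (List; []; _∷_; length; lookup; take)
open import Data.Bool.ListAction using (any)
open import Data.List.Membership.Propositional using (_∈_)
open import Data.List.Relation.Unary.All using (All)
open import Data.List.Relation.Unary.Any using (Any)
open import Data.List.Relation.Unary.Unique.Propositional using (Unique)
open import Relation.Binary.PropositionalEquality using (_≡_; _≢_)
open import Relation.Nullary using (¬_)

record Graph : Set₁ where
  field
    V   : Set
    Adj : V → V → Set
open Graph public

Subset : Set → Set
Subset V = V → Bool

module _ {V : Set} where

  _⊆_ : Subset V → Subset V → Set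
  S ⊆ R = ∀ v → T (S v) → T (R v)

  compl : Subset V → Subset V
  compl S v = not (S v)

  HasSize : ℕ → Subset V → Set
  HasSize k S = Σ (List V) λ xs →
    Unique xs × length xs ≡ k ×
    (∀ v → T (S v) → v ∈ xs) × (∀ v → v ∈ xs → T (S v))

-- Walk in the induced subgraph G[S] from x to y (x is assumed in S).
data Walk (G : Graph) (S : Subset (V G)) : V G → V G → Set where
  here : ∀ {x} → Walk G S x x
  step : ∀ {x y z} → Adj G x y → T (S y) → Walk G S y z → Walk G S x z

InducedConnected : (G : Graph) → Subset (V G) → Set
InducedConnected G S =
  ∀ x y → T (S x) → T (S y) → Walk G S x y

InducedDisconnected : (G : Graph) → Subset (V G) → Set
InducedDisconnected G S = ¬ InducedConnected G S

CutFacet : (G : Graph) → ℕ → Subset (V G) → Set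
CutFacet G k σ = HasSize k (compl σ) × InducedDisconnected G (compl σ)

Complex : Set → Set₁
Complex V = Subset V → Set

module _ {V : Set} where

  -- pure of dimension d - 1, i.e. all maximal faces have exactly d vertices
  PureOfSize : Complex V → ℕ → Set
  PureOfSize K d =
    (∀ τ → K τ → Σ (Subset V) λ ρ → K ρ × τ ⊆ ρ × HasSize d ρ) ×
    (∀ τ s → K τ → HasSize s τ → s ≤ d)

  -- A pure complex whose facets are described by the predicate Facet is
  -- shellable if its facets can be listed F₁,…,F_t so that for every j ≥ 2
  -- (0-based index i ≥ 1) the complex (⋃_{s<j} ⟨F_s⟩) ∩ ⟨F_j⟩ is pure of
  -- dimension dim F_j - 1, i.e. of size |F_j| - 1.
  Shellable : (Subset V → Set) → Set
  Shellable Facet = Σ (List (Subset V)) λ Fs →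
    All Facet Fs ×
    (∀ σ → Facet σ → Any (λ F → ∀ v → σ v ≡ F v) Fs) ×
    (∀ (i : Fin (length Fs)) → 1 ≤ toℕ i → ∀ s → HasSize s (lookup Fs i) →
       PureOfSize (λ τ → Any (λ F → τ ⊆ F) (take (toℕ i) Fs) × τ ⊆ lookup Fs i)
                  (s ∸ 1))

-- Hexagonal grid graph H_{1×m×n}
-- Hexagons have axial coordinates (p,q) ∈ ℕ × ℕ; the patch is 1≤p≤m, 1≤q≤n.
-- Corners of the honeycomb tiling correspond to triangles of three mutually
-- adjacent hexagon centres:
--   up   triangle (false,p,q) : {(p,q), (p+1,q), (p,q+1)}
--   down triangle (true ,p,q) : {(p+1,q), (p,q+1), (p+1,q+1)}
-- (every corner of a patch hexagon has p,q ≥ 0, so ℕ suffices).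

Center : Set
Center = ℕ × ℕ

Triangle : Set
Triangle = Bool × ℕ × ℕ

triCenters : Triangle → List Center
triCenters (false , p , q) = (p , q) ∷ (suc p , q) ∷ (p , suc q) ∷ []
triCenters (true  , p , q) = (suc p , q) ∷ (p , suc q) ∷ (suc p , suc q) ∷ []

inPatch : ℕ → ℕ → Center → Bool
inPatch m n (a , b) = (1 ≤ᵇ a) ∧ (a ≤ᵇ m) ∧ (1 ≤ᵇ b) ∧ (b ≤ᵇ n)

isCorner : ℕ → ℕ → Triangle → Bool
isCorner m n t = any (inPatch m n) (triCenters t)

HexV : ℕ → ℕ → Set
HexV m n = Σ Triangle λ t → T (isCorner m n t)

-- x,y adjacent iff they are the two endpoints of a side of a patch hexagon h:
-- both are corners of h and their triangles share a second centre c ≠ h.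
HexAdj : (m n : ℕ) → HexV m n → HexV m n → Set
HexAdj m n (x , _) (y , _) =
  x ≢ y × Σ Center λ h → Σ Center λ c →
    h ≢ c × T (inPatch m n h) ×
    h ∈ triCenters x × c ∈ triCenters x × h ∈ triCenters y × c ∈ triCenters y

Hex : ℕ → ℕ → Graph
Hex m n = record { V = HexV m n ; Adj = HexAdj m n }

{-# OPTIONS --safe #-}
module Submission where

-- A set t of three vertices induces a disconnected subgraph iff some vertex of t has no
-- neighbour in t, so the facets of Δ₃(G) are the complements of such "cut triples".  Along an enumeration w ∷ r of the vertices,
-- list first the cut triples inside r, then the cut triples {w, a, b} with a ≁ b, then those
-- with a ~ b.  By the usual criterion this is a shelling once every earlier triple t' has a
-- vertex y ∉ t such that t ∪ {y} contains an earlier cut triple.  For t = {w, a, b} with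
-- a ≁ b, take y ∈ t' ∖ t not adjacent to both a and b (without 4-cycles at most one vertex is
-- adjacent to both, and if that one is all of t' ∖ t then t' itself works): {a, b, y} is an
-- earlier cut triple.  For a ~ b, the vertex w is isolated and, without triangles, y is
-- adjacent to at most one of a, b: if y ~ a then {w, b, y} is an earlier cut triple with
-- b ≁ y, and if y is adjacent to neither then {a, b, y} is.

open import Defs
open import Data.Bool using (Bool; true; false; not; T; _∧_)
open import Data.Bool.Properties using (T-∧; T-irrelevant; not-involutive; not-¬)
import Data.Bool.Properties as Bool
open import Data.Empty using (⊥; ⊥-elim)
open import Data.Fin using (Fin; toℕ) renaming (zero to fzero; suc to fsuc)
open import Data.List using (List; []; _∷_; [_]; _++_; length; lookup; take; map; filter; upTo; cartesianProduct)
open import Data.List.Properties using (filter-notAll; map-++; ++-assoc; ++-identityʳ)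
open import Data.List.Membership.Propositional using (_∈_; _∉_; find; lose)
open import Data.List.Membership.Propositional.Properties
  using (∈-filter⁺; ∈-filter⁻; ∈-map⁺; ∈-map⁻; ∈-++⁺ˡ; ∈-++⁺ʳ; ∈-++⁻; ∈-cartesianProduct⁺; ∈-upTo⁺)
open import Data.List.Relation.Binary.Permutation.Propositional using (_↭_; refl; prep; swap; ↭-sym; ↭-trans)
open import Data.List.Relation.Binary.Permutation.Propositional.Properties
  using (All-resp-↭; Any-resp-↭; ∈-resp-↭; shift)
open import Data.List.Relation.Binary.Subset.Propositional using () renaming (_⊆_ to _⊆ᴸ_)
open import Data.List.Relation.Unary.All as All using (All; []; _∷_; all?)
import Data.List.Relation.Unary.All.Properties as All
open import Data.List.Relation.Unary.AllPairs using (AllPairs; []; _∷_)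
import Data.List.Relation.Unary.AllPairs.Properties as AllPairs
open import Data.List.Relation.Unary.Any as Any using (Any; here; there; any?)
import Data.List.Relation.Unary.Any.Properties as Any
open import Data.List.Relation.Unary.Unique.Propositional using (Unique)
import Data.List.Relation.Unary.Unique.Propositional.Properties as Unique
open import Data.Nat using (ℕ; suc; _≤_; _∸_; _≤ᵇ_; z≤n; s≤s)
import Data.Nat.Properties as ℕ
open import Data.Product using (Σ; ∃-syntax; ∃₂; _×_; _,_; proj₁; proj₂)
open import Data.Product.Properties using (≡-dec)
open import Data.Sum using (_⊎_; inj₁; inj₂)
import Data.Sum as Sum
open import Data.Unit using (⊤; tt)
open import Function using (_∘_; id; Equivalence)
open import Relation.Binary.Definitions using (DecidableEquality; Decidable)
open import Relation.Binary.PropositionalEquality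
  using (_≡_; _≢_; refl; sym; cong; subst; ≢-sym; module ≡-Reasoning)
open import Relation.Nullary using (¬_; Dec; yes; no)
open import Relation.Nullary.Decidable
  using ( ⌊_⌋; ¬?; _×-dec_; T?; map′; decidable-stable
        ; toWitness; fromWitness; toWitnessFalse; fromWitnessFalse)

module _ {A : Set} (_≟_ : DecidableEquality A) where

  remove : A → List A → List A
  remove x = filter (λ v → ¬? (v ≟ x))

  ∈-remove⁺ : ∀ {v x xs} → v ∈ xs → v ≢ x → v ∈ remove x xs
  ∈-remove⁺ {x = x} = ∈-filter⁺ (λ v → ¬? (v ≟ x))

  ∈-remove⁻ : ∀ {v x xs} → v ∈ remove x xs → v ∈ xs × v ≢ x
  ∈-remove⁻ {x = x} = ∈-filter⁻ (λ v → ¬? (v ≟ x))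

  remove-unique : ∀ {x xs} → Unique xs → Unique (remove x xs)
  remove-unique {x} = Unique.filter⁺ (λ v → ¬? (v ≟ x))

  length-mono-⊆ : ∀ {xs ys : List A} → Unique xs → xs ⊆ᴸ ys → length xs ≤ length ys
  length-mono-⊆ {[]} _ _ = z≤n
  length-mono-⊆ {x ∷ xs} {ys} (x∉xs ∷ xs-unique) xs⊆ys =
    ℕ.≤-<-trans (length-mono-⊆ xs-unique xs⊆remove)
                (filter-notAll _ ys (lose (xs⊆ys (here refl)) λ x≢x → x≢x refl))
    where
    xs⊆remove : xs ⊆ᴸ remove x ys
    xs⊆remove v∈xs = ∈-remove⁺ (xs⊆ys (there v∈xs)) λ { refl → All.lookup x∉xs v∈xs refl }

  length-remove : ∀ {x xs} → Unique xs → x ∈ xs → suc (length (remove x xs)) ≡ length xs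
  length-remove {x} {xs} xs-unique x∈xs =
    ℕ.≤-antisym (filter-notAll _ xs (lose x∈xs λ x≢x → x≢x refl))
                (length-mono-⊆ xs-unique xs⊆x∷remove)
    where
    xs⊆x∷remove : xs ⊆ᴸ x ∷ remove x xs
    xs⊆x∷remove {v} v∈xs with v ≟ x
    ... | yes refl = here refl
    ... | no v≢x = there (∈-remove⁺ v∈xs v≢x)

module _ {A : Set} where

  Incremental : (List A → A → Set) → List A → List A → Set
  Incremental P acc [] = ⊤
  Incremental P acc (x ∷ xs) = P acc x × Incremental P (acc ++ [ x ]) xs

  Incremental-++ : ∀ {P} acc xs {ys} → Incremental P acc xs → Incremental P (acc ++ xs) ys →
                   Incremental P acc (xs ++ ys)
  Incremental-++ {P} acc [] {ys} _ inc = subst (λ acc → Incremental P acc ys) (++-identityʳ acc) inc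
  Incremental-++ {P} acc (x ∷ xs) {ys} (px , incxs) incys =
    px , Incremental-++ (acc ++ [ x ]) xs incxs
           (subst (λ acc → Incremental P acc ys) (sym (++-assoc acc [ x ] xs)) incys)

  Incremental-lookup : ∀ {P acc} xs → Incremental P acc xs → (i : Fin (length xs)) →
                       P (acc ++ take (toℕ i) xs) (lookup xs i)
  Incremental-lookup {P} {acc} (x ∷ xs) (px , _) fzero = subst (λ acc → P acc x) (sym (++-identityʳ acc)) px
  Incremental-lookup {P} {acc} (x ∷ xs) (_ , inc) (fsuc i) =
    subst (λ acc → P acc (lookup xs i)) (++-assoc acc [ x ] (take (toℕ i) xs)) (Incremental-lookup xs inc i)

  Incremental-block : ∀ {P : List A → A → Set} {R : A → A → Set} {S : A → Set} base →
    (∀ {pre x} → All S pre → S x → All (λ y → R y x) pre → P (base ++ pre) x) →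
    ∀ {xs} → AllPairs R xs → All S xs → Incremental P base xs
  Incremental-block {P} {R} {S} base extend xs-apart xs-S =
    subst (λ acc → Incremental P acc _) (++-identityʳ base) (go [] [] [] xs-apart xs-S)
    where
    go : ∀ pre {xs} → All S pre → All (λ y → All (R y) xs) pre → AllPairs R xs → All S xs →
         Incremental P (base ++ pre) xs
    go pre pre-S pre-apart [] [] = tt
    go pre {x ∷ xs} pre-S pre-apart (x-apart ∷ xs-apart) (x-S ∷ xs-S) =
      extend pre-S x-S (All.map All.head pre-apart) ,
      subst (λ acc → Incremental P acc xs) (sym (++-assoc base pre [ x ]))
        (go (pre ++ [ x ]) (All.++⁺ pre-S (x-S ∷ []))
            (All.++⁺ (All.map All.tail pre-apart) (x-apart ∷ [])) xs-apart xs-S)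

module _ {A B : Set} (f : A → B) where

  Incremental-map : ∀ {P Q} → (∀ {acc x} → P acc x → Q (map f acc) (f x)) →
                    ∀ {acc} xs → Incremental P acc xs → Incremental Q (map f acc) (map f xs)
  Incremental-map extend [] tt = tt
  Incremental-map {Q = Q} extend {acc} (x ∷ xs) (px , inc) =
    extend px , subst (λ acc → Incremental Q acc (map f xs)) (map-++ f acc [ x ]) (Incremental-map extend xs inc)

module ShellingCriterion {V : Set} (_≟_ : DecidableEquality V) where

  infixl 30 _─_
  _─_ : Subset V → V → Subset V
  (F ─ x) v = F v ∧ not ⌊ v ≟ x ⌋

  ─⁺ : ∀ {F : Subset V} {x v} → T (F v) → v ≢ x → T ((F ─ x) v)
  ─⁺ {F} {x} {v} Fv v≢x = Equivalence.from (T-∧ {F v}) (Fv , fromWitnessFalse v≢x)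

  ─⁻ : ∀ {F : Subset V} {x v} → T ((F ─ x) v) → T (F v) × v ≢ x
  ─⁻ {F} {x} {v} F─x-v = let Fv , v≢x = Equivalence.to (T-∧ {F v}) F─x-v in Fv , toWitnessFalse v≢x

  HasSize-─ : ∀ {s} {F : Subset V} {x} → HasSize s F → T (F x) → HasSize (s ∸ 1) (F ─ x)
  HasSize-─ {F = F} {x} (xs , xs-unique , refl , F⇒∈ , ∈⇒F) Fx =
    remove _≟_ x xs , remove-unique _≟_ xs-unique , cong (_∸ 1) (length-remove _≟_ xs-unique (F⇒∈ x Fx)) ,
    (λ v F─x-v → let Fv , v≢x = ─⁻ {F} F─x-v in ∈-remove⁺ _≟_ (F⇒∈ v Fv) v≢x) ,
    (λ v v∈ → let v∈xs , v≢x = ∈-remove⁻ _≟_ v∈ in ─⁺ {F} (∈⇒F v v∈xs) v≢x)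

  HasSize-mono : ∀ {a b} {τ ρ : Subset V} → τ ⊆ ρ → HasSize a τ → HasSize b ρ → a ≤ b
  HasSize-mono τ⊆ρ (xs , xs-unique , refl , τ⇒∈ , ∈⇒τ) (ys , _ , refl , ρ⇒∈ , _) =
    length-mono-⊆ _≟_ xs-unique λ {v} v∈xs → ρ⇒∈ v (τ⊆ρ v (∈⇒τ v v∈xs))

  ShellingStep : List (Subset V) → Subset V → Set
  ShellingStep Fs F = ∀ {F'} → F' ∈ Fs → ∃[ x ] (T (F x) × ¬ T (F' x) × Any (λ F'' → F ─ x ⊆ F'') Fs)

  module _ {Fs : List (Subset V)} {F : Subset V} (shelling : ShellingStep Fs F) where

    private
      IntersectionFace : Subset V → Set
      IntersectionFace τ = Any (λ F' → τ ⊆ F') Fs × τ ⊆ F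

      ridge-above : ∀ {τ : Subset V} → IntersectionFace τ →
                    ∃[ x ] (T (F x) × IntersectionFace (F ─ x) × τ ⊆ F ─ x)
      ridge-above (τ⊆Fs , τ⊆F) with find τ⊆Fs
      ... | F' , F'∈Fs , τ⊆F' with shelling F'∈Fs
      ... | x , Fx , ¬F'x , F─x⊆Fs =
        x , Fx , (F─x⊆Fs , λ v → proj₁ ∘ ─⁻ {F}) ,
        λ v τv → ─⁺ {F} (τ⊆F v τv) λ { refl → ¬F'x (τ⊆F' v τv) }

    step⇒pure : ∀ {s} → HasSize s F → PureOfSize IntersectionFace (s ∸ 1)
    step⇒pure {s} F-size = extend , bounded
      where
      extend : ∀ τ → IntersectionFace τ →
               Σ (Subset V) λ ρ → IntersectionFace ρ × τ ⊆ ρ × HasSize (s ∸ 1) ρ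
      extend τ τ-face = let x , Fx , ridge , τ⊆ridge = ridge-above τ-face in
        F ─ x , ridge , τ⊆ridge , HasSize-─ F-size Fx
      bounded : ∀ τ a → IntersectionFace τ → HasSize a τ → a ≤ s ∸ 1
      bounded τ a τ-face τ-size = let x , Fx , _ , τ⊆ridge = ridge-above τ-face in
        HasSize-mono τ⊆ridge τ-size (HasSize-─ F-size Fx)

  shellable-bySteps : ∀ {Facet : Subset V → Set} (Fs : List (Subset V)) → All Facet Fs →
    (∀ σ → Facet σ → Any (λ F → ∀ v → σ v ≡ F v) Fs) → Incremental ShellingStep [] Fs → Shellable Facet
  shellable-bySteps Fs facets covers steps =
    Fs , facets , covers , λ i _ s size → step⇒pure (Incremental-lookup Fs steps i) size

module GirthFive (G : Graph) (_≟_ : DecidableEquality (V G)) (adj? : Decidable (Adj G))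
  (adj-sym : ∀ {x y} → Adj G x y → Adj G y x)
  (adj-irrefl : ∀ {x y} → Adj G x y → x ≢ y)
  (triangle-free : ∀ {x y z} → Adj G x y → Adj G y z → Adj G x z → ⊥)
  (square-free : ∀ {a b y y'} → a ≢ b → Adj G a y → Adj G b y → Adj G a y' → Adj G b y' → y ≡ y')
  where

  open import Data.List.Membership.DecPropositional _≟_ using (_∈?_)
  open ShellingCriterion _≟_

  Vertex : Set
  Vertex = V G

  infix 4 _~_ _⊈_
  _~_ : Vertex → Vertex → Set
  _~_ = Adj G

  _⊈_ : List Vertex → List Vertex → Set
  s ⊈ t = Any (_∉ t) s

  ⊆-or-⊈ : ∀ s t → s ⊆ᴸ t ⊎ s ⊈ t
  ⊆-or-⊈ s t with all? (_∈? t) s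
  ... | yes s⊆t = inj₁ (All.lookup s⊆t)
  ... | no s⊈t = inj₂ (All.¬All⇒Any¬ (_∈? t) s s⊈t)

  outside : List Vertex → Subset Vertex
  outside t v = not ⌊ v ∈? t ⌋

  ∉⇒outside : ∀ {t v} → v ∉ t → T (outside t v)
  ∉⇒outside = fromWitnessFalse

  outside⇒∉ : ∀ {t v} → T (outside t v) → v ∉ t
  outside⇒∉ = toWitnessFalse

  ∈⇒compl-outside : ∀ {t v} → v ∈ t → T (compl (outside t) v)
  ∈⇒compl-outside {t} {v} v∈t = subst T (sym (not-involutive ⌊ v ∈? t ⌋)) (fromWitness v∈t)

  compl-outside⇒∈ : ∀ {t v} → T (compl (outside t) v) → v ∈ t
  compl-outside⇒∈ {t} {v} h = toWitness (subst T (not-involutive ⌊ v ∈? t ⌋) h)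

  Isolated : List Vertex → Vertex → Set
  Isolated t v = All (λ u → ¬ v ~ u) t

  HasIsolated : List Vertex → Set
  HasIsolated t = Any (Isolated t) t

  hasIsolated? : ∀ t → Dec (HasIsolated t)
  hasIsolated? t = any? (λ v → all? (λ u → ¬? (adj? v u)) t) t

  HasIsolated-resp-↭ : ∀ {s t} → s ↭ t → HasIsolated s → HasIsolated t
  HasIsolated-resp-↭ s↭t = Any-resp-↭ s↭t ∘ Any.map (All-resp-↭ s↭t)

  HasSize-compl-outside : ∀ {t} → Unique t → HasSize (length t) (compl (outside t))
  HasSize-compl-outside {t} t-unique =
    t , t-unique , refl , (λ v → compl-outside⇒∈) , (λ v → ∈⇒compl-outside)

  isolated⇒disconnected : ∀ {t v u} → v ∈ t → u ∈ t → v ≢ u → Isolated t v →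
                          InducedDisconnected G (compl (outside t))
  isolated⇒disconnected v∈t u∈t v≢u v-isolated connected
    with connected _ _ (∈⇒compl-outside v∈t) (∈⇒compl-outside u∈t)
  ... | here = v≢u refl
  ... | step v~z z∈t _ = All.lookup v-isolated (compl-outside⇒∈ z∈t) v~z

  other-element : ∀ {t v} → Unique t → 2 ≤ length t → ∃[ u ] (u ∈ t × v ≢ u)
  other-element {x ∷ []} _ (s≤s ())
  other-element {x ∷ y ∷ _} {v} ((x≢y ∷ _) ∷ _) _ with v ≟ x
  ... | yes refl = y , there (here refl) , x≢y
  ... | no v≢x = x , here refl , v≢x

  outside-cutFacet : ∀ {t} → Unique t → 2 ≤ length t → HasIsolated t → CutFacet G (length t) (outside t)
  outside-cutFacet t-unique 2≤|t| t-isolated with find t-isolated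
  ... | v , v∈t , v-isolated =
    let u , u∈t , v≢u = other-element t-unique 2≤|t| in
    HasSize-compl-outside t-unique , isolated⇒disconnected v∈t u∈t v≢u v-isolated

  neighbour-in : ∀ {t x} → ¬ HasIsolated t → x ∈ t → Any (x ~_) t
  neighbour-in {t} {x} no-isolated x∈t =
    Any.map (decidable-stable (adj? x _)) (All.¬All⇒Any¬ (λ u → ¬? (adj? x u)) t (no-isolated ∘ lose x∈t))

  connected-unless-isolated : ∀ {t S} → length t ≡ 3 →
                              (∀ v → T (S v) → v ∈ t) → (∀ v → v ∈ t → T (S v)) →
                              ¬ HasIsolated t → InducedConnected G S
  connected-unless-isolated {t} {S} |t|≡3 S⇒∈ ∈⇒S no-isolated x y Sx Sy with x ≟ y
  ... | yes refl = here
  ... | no x≢y with adj? x y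
  ...   | yes x~y = step x~y Sy here
  ...   | no x≁y with any? (λ z → adj? x z ×-dec adj? z y) t
  ...     | yes common = let z , z∈t , x~z , z~y = find common in step x~z (∈⇒S z z∈t) (step z~y Sy here)
  ...     | no no-common
    with find (neighbour-in no-isolated (S⇒∈ x Sx)) | find (neighbour-in no-isolated (S⇒∈ y Sy))
  ...       | z , z∈t , x~z | z' , z'∈t , y~z' = ⊥-elim (four-in-three (length-mono-⊆ _≟_ distinct ⊆t))
    where
    distinct : Unique (x ∷ y ∷ z ∷ z' ∷ [])
    distinct = (x≢y ∷ adj-irrefl x~z ∷ (λ { refl → x≁y (adj-sym y~z') }) ∷ [])
             ∷ ((λ { refl → x≁y x~z }) ∷ adj-irrefl y~z' ∷ [])
             ∷ ((λ { refl → no-common (lose z∈t (x~z , adj-sym y~z')) }) ∷ [])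
             ∷ [] ∷ []
    ⊆t : x ∷ y ∷ z ∷ z' ∷ [] ⊆ᴸ t
    ⊆t (here refl) = S⇒∈ x Sx
    ⊆t (there (here refl)) = S⇒∈ y Sy
    ⊆t (there (there (here refl))) = z∈t
    ⊆t (there (there (there (here refl)))) = z'∈t
    four-in-three : ¬ 4 ≤ length t
    four-in-three 4≤|t| with s≤s (s≤s (s≤s ())) ← subst (4 ≤_) |t|≡3 4≤|t|

  pairs : List Vertex → List (Vertex × Vertex)
  pairs [] = []
  pairs (a ∷ r) = map (a ,_) r ++ pairs r

  pairs-sound : ∀ {r a b} → Unique r → (a , b) ∈ pairs r → a ∈ r × b ∈ r × a ≢ b
  pairs-sound {x ∷ r} (x∉r ∷ r-unique) ab∈ with ∈-++⁻ (map (x ,_) r) ab∈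
  ... | inj₁ ab∈map with ∈-map⁻ (x ,_) ab∈map
  ...   | b , b∈r , refl = here refl , there b∈r , All.lookup x∉r b∈r
  pairs-sound {x ∷ r} (_ ∷ r-unique) ab∈ | inj₂ ab∈pairs =
    let a∈r , b∈r , a≢b = pairs-sound r-unique ab∈pairs in there a∈r , there b∈r , a≢b

  pairs-complete : ∀ {r a b} → a ∈ r → b ∈ r → a ≢ b → (a , b) ∈ pairs r ⊎ (b , a) ∈ pairs r
  pairs-complete {x ∷ r} (here refl) (here refl) a≢b = ⊥-elim (a≢b refl)
  pairs-complete {x ∷ r} (here refl) (there b∈r) _ = inj₁ (∈-++⁺ˡ (∈-map⁺ (x ,_) b∈r))
  pairs-complete {x ∷ r} (there a∈r) (here refl) _ = inj₂ (∈-++⁺ˡ (∈-map⁺ (x ,_) a∈r))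
  pairs-complete {x ∷ r} (there a∈r) (there b∈r) a≢b =
    Sum.map (∈-++⁺ʳ (map (x ,_) r)) (∈-++⁺ʳ (map (x ,_) r)) (pairs-complete a∈r b∈r a≢b)

  triple : Vertex → Vertex × Vertex → List Vertex
  triple w (a , b) = w ∷ a ∷ b ∷ []

  ∉-triple : ∀ {y w a b} → y ≢ w → y ≢ a → y ≢ b → y ∉ triple w (a , b)
  ∉-triple y≢w y≢a y≢b = All.All¬⇒¬Any (y≢w ∷ y≢a ∷ y≢b ∷ [])

  triples-apart : ∀ {w r} → w ∉ r → Unique r → AllPairs (λ p q → triple w p ⊈ triple w q) (pairs r)
  triples-apart {w} {[]} _ _ = []
  triples-apart {w} {x ∷ r} w∉x∷r (x∉r ∷ r-unique) =
    AllPairs.++⁺ (AllPairs.map⁺ (same-apex w≢r x∉r r-unique)) (triples-apart (w∉x∷r ∘ there) r-unique)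
      (All.map⁺ (All.tabulate λ {b} _ → All.tabulate λ cd∈ →
        let c∈r , d∈r , _ = pairs-sound r-unique cd∈ in
        there (here (∉-triple (≢-sym (w∉x∷r ∘ here)) (All.lookup x∉r c∈r) (All.lookup x∉r d∈r)))))
    where
    w≢r : All (w ≢_) r
    w≢r = All.¬Any⇒All¬ r (w∉x∷r ∘ there)
    same-apex : ∀ {ys} → All (w ≢_) ys → All (x ≢_) ys → Unique ys →
                AllPairs (λ b b' → triple w (x , b) ⊈ triple w (x , b')) ys
    same-apex [] [] [] = []
    same-apex (w≢b ∷ w≢ys) (x≢b ∷ x≢ys) (b≢ys ∷ ys-unique) =
      All.map (λ b≢b' → there (there (here (∉-triple (≢-sym w≢b) (≢-sym x≢b) b≢b')))) b≢ys
      ∷ same-apex w≢ys x≢ys ys-unique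

  module _ (w : Vertex) {P : Vertex × Vertex → Set} (P? : ∀ p → Dec (P p)) where

    block : List Vertex → List (List Vertex)
    block r = map (triple w) (filter P? (pairs r))

    ∈-block⁻ : ∀ r {t} → t ∈ block r → ∃[ p ] (p ∈ pairs r × P p × t ≡ triple w p)
    ∈-block⁻ r t∈ with ∈-map⁻ (triple w) t∈
    ... | p , p∈ , refl = let p∈pairs , Pp = ∈-filter⁻ P? p∈ in p , p∈pairs , Pp , refl

    ∈-block-↭ : ∀ {r a b} → (∀ {a b} → P (a , b) → P (b , a)) →
                a ∈ r → b ∈ r → a ≢ b → P (a , b) → ∃[ t ] (t ∈ block r × t ↭ triple w (a , b))
    ∈-block-↭ {a = a} {b} P-sym a∈r b∈r a≢b Pab with pairs-complete a∈r b∈r a≢b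
    ... | inj₁ ab∈ = triple w (a , b) , ∈-map⁺ (triple w) (∈-filter⁺ P? ab∈ Pab) , refl
    ... | inj₂ ba∈ =
      triple w (b , a) , ∈-map⁺ (triple w) (∈-filter⁺ P? ba∈ (P-sym Pab)) , prep w (swap b a refl)

    block-apart : ∀ {r} → w ∉ r → Unique r → AllPairs _⊈_ (block r)
    block-apart w∉r r-unique = AllPairs.map⁺ (AllPairs.filter⁺ P? (triples-apart w∉r r-unique))

  NonEdgeCut EdgeCut : Vertex → Vertex × Vertex → Set
  NonEdgeCut w (a , b) = ¬ a ~ b × HasIsolated (triple w (a , b))
  EdgeCut w (a , b) = a ~ b × HasIsolated (triple w (a , b))

  nonEdgeCut? : ∀ w p → Dec (NonEdgeCut w p)
  nonEdgeCut? w (a , b) = ¬? (adj? a b) ×-dec hasIsolated? (triple w (a , b))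

  edgeCut? : ∀ w p → Dec (EdgeCut w p)
  edgeCut? w (a , b) = adj? a b ×-dec hasIsolated? (triple w (a , b))

  nonEdgeCuts edgeCuts : Vertex → List Vertex → List (List Vertex)
  nonEdgeCuts w = block w (nonEdgeCut? w)
  edgeCuts w = block w (edgeCut? w)

  HasIsolated-swap : ∀ {w a b} → HasIsolated (triple w (a , b)) → HasIsolated (triple w (b , a))
  HasIsolated-swap {w} {a} {b} = HasIsolated-resp-↭ (prep w (swap a b refl))

  ∈-nonEdgeCuts-↭ : ∀ {w r a b} → a ∈ r → b ∈ r → a ≢ b → NonEdgeCut w (a , b) →
                    ∃[ t ] (t ∈ nonEdgeCuts w r × t ↭ triple w (a , b))
  ∈-nonEdgeCuts-↭ {w} =
    ∈-block-↭ w (nonEdgeCut? w) λ (a≁b , iso) → a≁b ∘ adj-sym , HasIsolated-swap iso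

  ∈-edgeCuts-↭ : ∀ {w r a b} → a ∈ r → b ∈ r → a ≢ b → EdgeCut w (a , b) →
                 ∃[ t ] (t ∈ edgeCuts w r × t ↭ triple w (a , b))
  ∈-edgeCuts-↭ {w} = ∈-block-↭ w (edgeCut? w) λ (a~b , iso) → adj-sym a~b , HasIsolated-swap iso

  cutTriples : List Vertex → List (List Vertex)
  cutTriples [] = []
  cutTriples (w ∷ r) = cutTriples r ++ nonEdgeCuts w r ++ edgeCuts w r

  CutTriple : List Vertex → List Vertex → Set
  CutTriple vs t = Unique t × length t ≡ 3 × t ⊆ᴸ vs × HasIsolated t

  triple-cutTriple : ∀ {w r p} → w ∉ r → Unique r → p ∈ pairs r → HasIsolated (triple w p) →
                     CutTriple (w ∷ r) (triple w p)
  triple-cutTriple {w} {r} {a , b} w∉r r-unique ab∈ iso with pairs-sound r-unique ab∈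
  ... | a∈r , b∈r , a≢b = ((w≢ a∈r ∷ w≢ b∈r ∷ []) ∷ (a≢b ∷ []) ∷ [] ∷ []) , refl , ⊆w∷r , iso
    where
    w≢ : ∀ {v} → v ∈ r → w ≢ v
    w≢ v∈r refl = w∉r v∈r
    ⊆w∷r : triple w (a , b) ⊆ᴸ w ∷ r
    ⊆w∷r (here refl) = here refl
    ⊆w∷r (there (here refl)) = there a∈r
    ⊆w∷r (there (there (here refl))) = there b∈r

  block-cutTriple : ∀ {w r t} {P : Vertex × Vertex → Set} (P? : ∀ p → Dec (P p)) →
                    (∀ {p} → P p → HasIsolated (triple w p)) →
                    w ∉ r → Unique r → t ∈ block w P? r → CutTriple (w ∷ r) t
  block-cutTriple {w} {r} P? P⇒iso w∉r r-unique t∈ with ∈-block⁻ w P? r t∈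
  ... | p , p∈ , Pp , refl = triple-cutTriple w∉r r-unique p∈ (P⇒iso Pp)

  cutTriples-sound : ∀ {vs t} → Unique vs → t ∈ cutTriples vs → CutTriple vs t
  cutTriples-sound {w ∷ r} (w∉r ∷ r-unique) t∈ with ∈-++⁻ (cutTriples r) t∈
  ... | inj₁ t∈r =
    let t-unique , |t|≡3 , t⊆r , iso = cutTriples-sound r-unique t∈r in t-unique , |t|≡3 , there ∘ t⊆r , iso
  ... | inj₂ t∈blocks with ∈-++⁻ (nonEdgeCuts w r) t∈blocks
  ...   | inj₁ t∈ne =
    block-cutTriple {P = NonEdgeCut w} (nonEdgeCut? w) proj₂ (All.All¬⇒¬Any w∉r) r-unique t∈ne
  ...   | inj₂ t∈e =
    block-cutTriple {P = EdgeCut w} (edgeCut? w) proj₂ (All.All¬⇒¬Any w∉r) r-unique t∈e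

  ∈-blocks-↭ : ∀ {w r a b} → a ∈ r → b ∈ r → a ≢ b → HasIsolated (triple w (a , b)) →
               ∃[ t ] (t ∈ nonEdgeCuts w r ++ edgeCuts w r × t ↭ triple w (a , b))
  ∈-blocks-↭ {w} {r} {a} {b} a∈r b∈r a≢b iso with adj? a b
  ... | no a≁b =
    let t , t∈ , t↭ = ∈-nonEdgeCuts-↭ a∈r b∈r a≢b (a≁b , iso) in t , ∈-++⁺ˡ t∈ , t↭
  ... | yes a~b =
    let t , t∈ , t↭ = ∈-edgeCuts-↭ a∈r b∈r a≢b (a~b , iso) in t , ∈-++⁺ʳ (nonEdgeCuts w r) t∈ , t↭

  triple-↭ : ∀ {w t} → Unique t → length t ≡ 3 → w ∈ t →
          ∃₂ λ a b → Unique (triple w (a , b)) × triple w (a , b) ↭ t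
  triple-↭ {t = x ∷ y ∷ z ∷ []} t-unique@((x≢y ∷ x≢z ∷ []) ∷ (y≢z ∷ []) ∷ [] ∷ []) refl (here refl) =
    y , z , t-unique , refl
  triple-↭ {t = x ∷ y ∷ z ∷ []} ((x≢y ∷ x≢z ∷ []) ∷ (y≢z ∷ []) ∷ [] ∷ []) refl (there (here refl)) =
    x , z , ((≢-sym x≢y ∷ y≢z ∷ []) ∷ (x≢z ∷ []) ∷ [] ∷ []) , swap y x refl
  triple-↭ {t = x ∷ y ∷ z ∷ []} ((x≢y ∷ x≢z ∷ []) ∷ (y≢z ∷ []) ∷ [] ∷ []) refl (there (there (here refl))) =
    x , y , ((≢-sym x≢z ∷ ≢-sym y≢z ∷ []) ∷ (x≢y ∷ []) ∷ [] ∷ []) , ↭-sym (shift z (x ∷ y ∷ []) [])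

  cutTriples-complete : ∀ {vs t} → Unique vs → CutTriple vs t → ∃[ t' ] (t' ∈ cutTriples vs × t' ↭ t)
  cutTriples-complete {[]} _ (_ , _ , t⊆[] , iso) with () ← t⊆[] (proj₁ (proj₂ (find iso)))
  cutTriples-complete {w ∷ r} {t} (w∉r ∷ r-unique) (t-unique , |t|≡3 , t⊆w∷r , iso) with w ∈? t
  ... | no w∉t =
    let t' , t'∈ , t'↭t = cutTriples-complete r-unique (t-unique , |t|≡3 , t⊆r , iso) in t' , ∈-++⁺ˡ t'∈ , t'↭t
    where
    t⊆r : t ⊆ᴸ r
    t⊆r v∈t = Any.tail (λ { refl → w∉t v∈t }) (t⊆w∷r v∈t)
  ... | yes w∈t with triple-↭ t-unique |t|≡3 w∈t
  ...   | a , b , ((w≢a ∷ w≢b ∷ []) ∷ (a≢b ∷ []) ∷ [] ∷ []) , wab↭t =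
    let t' , t'∈ , t'↭wab = ∈-blocks-↭ (in-r (there (here refl)) (≢-sym w≢a))
                                       (in-r (there (there (here refl))) (≢-sym w≢b))
                                       a≢b (HasIsolated-resp-↭ (↭-sym wab↭t) iso)
    in t' , ∈-++⁺ʳ (cutTriples r) t'∈ , ↭-trans t'↭wab wab↭t
    where
    in-r : ∀ {v} → v ∈ triple w (a , b) → v ≢ w → v ∈ r
    in-r v∈ v≢w = Any.tail v≢w (t⊆w∷r (∈-resp-↭ wab↭t v∈))

  Exchange : List (List Vertex) → List Vertex → Set
  Exchange acc t = ∀ {t'} → t' ∈ acc → ∃[ y ] (y ∈ t' × y ∉ t × Any (_⊆ᴸ y ∷ t) acc)

  ≁-refl : ∀ {x} → ¬ x ~ x
  ≁-refl x~x = adj-irrefl x~x refl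

  apex-isolated : ∀ {w a b} → a ~ b → HasIsolated (triple w (a , b)) → ¬ w ~ a × ¬ w ~ b
  apex-isolated a~b (here (_ ∷ w≁a ∷ w≁b ∷ [])) = w≁a , w≁b
  apex-isolated a~b (there (here (_ ∷ _ ∷ a≁b ∷ []))) = ⊥-elim (a≁b a~b)
  apex-isolated a~b (there (there (here (_ ∷ b≁a ∷ _ ∷ [])))) = ⊥-elim (b≁a (adj-sym a~b))

  cutTriple-⊈ : ∀ {w r t' a b} → w ∉ r → CutTriple r t' → t' ⊈ triple w (a , b)
  cutTriple-⊈ {w} {t' = t'} {a} {b} w∉r (t'-unique , |t'|≡3 , t'⊆r , _) with ⊆-or-⊈ t' (triple w (a , b))
  ... | inj₂ t'⊈ = t'⊈
  ... | inj₁ t'⊆ = ⊥-elim (three-in-two (length-mono-⊆ _≟_ t'-unique t'⊆ab))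
    where
    t'⊆ab : t' ⊆ᴸ a ∷ b ∷ []
    t'⊆ab v∈t' = Any.tail (λ { refl → w∉r (t'⊆r v∈t') }) (t'⊆ v∈t')
    three-in-two : ¬ length t' ≤ 2
    three-in-two |t'|≤2 with s≤s (s≤s ()) ← subst (_≤ 2) |t'|≡3 |t'|≤2

  nonEdge-⊈-edge : ∀ {w c d a b} → c ≢ w → d ≢ w → c ≢ d → ¬ c ~ d → a ~ b →
                   triple w (c , d) ⊈ triple w (a , b)
  nonEdge-⊈-edge {w} {c} {d} {a} {b} c≢w d≢w c≢d c≁d a~b with ⊆-or-⊈ (triple w (c , d)) (triple w (a , b))
  ... | inj₂ wcd⊈ = wcd⊈
  ... | inj₁ wcd⊆ =
    ⊥-elim (apart (Any.tail c≢w (wcd⊆ (there (here refl)))) (Any.tail d≢w (wcd⊆ (there (there (here refl))))))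
    where
    apart : c ∈ a ∷ b ∷ [] → d ∈ a ∷ b ∷ [] → ⊥
    apart (here refl) (here refl) = c≢d refl
    apart (here refl) (there (here refl)) = c≁d a~b
    apart (there (here refl)) (here refl) = c≁d (adj-sym a~b)
    apart (there (here refl)) (there (here refl)) = c≢d refl

  module _ {w : Vertex} {r} (w∉r : w ∉ r) (r-unique : Unique r) where

    private
      in-r : ∀ {t' t y} → t' ⊆ᴸ w ∷ r → w ∈ t → y ∈ t' → y ∉ t → y ∈ r
      in-r t'⊆w∷r w∈t y∈t' y∉t = Any.tail (λ { refl → y∉t w∈t }) (t'⊆w∷r y∈t')

    module _ {a b} (a∈r : a ∈ r) (b∈r : b ∈ r) (a≢b : a ≢ b)
             {acc : List (List Vertex)} (cutTriples⊆acc : cutTriples r ⊆ᴸ acc) where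

      private
        t = triple w (a , b)

        abY-exchange : ∀ {y} → y ∈ r → y ∉ t → HasIsolated (a ∷ b ∷ y ∷ []) → Any (_⊆ᴸ y ∷ t) acc
        abY-exchange {y} y∈r y∉t iso =
          let s , s∈ , s↭ = cutTriples-complete r-unique (abY-unique , refl , abY⊆r , iso)
          in lose (cutTriples⊆acc s∈) (abY⊆ ∘ ∈-resp-↭ s↭)
          where
          abY-unique : Unique (a ∷ b ∷ y ∷ [])
          abY-unique = (a≢b ∷ (λ { refl → y∉t (there (here refl)) }) ∷ [])
                     ∷ ((λ { refl → y∉t (there (there (here refl))) }) ∷ []) ∷ [] ∷ []
          abY⊆r : a ∷ b ∷ y ∷ [] ⊆ᴸ r
          abY⊆r (here refl) = a∈r
          abY⊆r (there (here refl)) = b∈r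
          abY⊆r (there (there (here refl))) = y∈r
          abY⊆ : a ∷ b ∷ y ∷ [] ⊆ᴸ y ∷ t
          abY⊆ (here refl) = there (there (here refl))
          abY⊆ (there (here refl)) = there (there (there (here refl)))
          abY⊆ (there (there (here refl))) = here refl

        abY-isolated : ∀ {y} → ¬ a ~ b → ¬ (a ~ y × b ~ y) → HasIsolated (a ∷ b ∷ y ∷ [])
        abY-isolated {y} a≁b ¬both with adj? a y
        ... | no a≁y = here (≁-refl ∷ a≁b ∷ a≁y ∷ [])
        ... | yes a~y = there (here ((a≁b ∘ adj-sym) ∷ ≁-refl ∷ (λ b~y → ¬both (a~y , b~y)) ∷ []))

      nonEdge-exchange : ¬ a ~ b → ∀ {t'} → t' ∈ acc → t' ⊆ᴸ w ∷ r → t' ⊈ t →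
                         ∃[ y ] (y ∈ t' × y ∉ t × Any (_⊆ᴸ y ∷ t) acc)
      nonEdge-exchange a≁b {t'} t'∈ t'⊆w∷r t'⊈t with find t'⊈t
      ... | y , y∈t' , y∉t with adj? a y ×-dec adj? b y
      ...   | no ¬both =
        y , y∈t' , y∉t , abY-exchange (in-r t'⊆w∷r (here refl) y∈t' y∉t) y∉t (abY-isolated a≁b ¬both)
      ...   | yes (a~y , b~y) with ⊆-or-⊈ t' (y ∷ t)
      ...     | inj₁ t'⊆y∷t = y , y∈t' , y∉t , lose t'∈ t'⊆y∷t
      ...     | inj₂ t'⊈y∷t with find t'⊈y∷t
      ...       | v , v∈t' , v∉y∷t =
        v , v∈t' , v∉t ,
        abY-exchange (in-r t'⊆w∷r (here refl) v∈t' v∉t) v∉t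
          (abY-isolated a≁b λ (a~v , b~v) → v≢y (sym (square-free a≢b a~y b~y a~v b~v)))
        where
        v∉t : v ∉ t
        v∉t = v∉y∷t ∘ there
        v≢y : v ≢ y
        v≢y = v∉y∷t ∘ here

      edge-exchange : a ~ b → ¬ w ~ a → ¬ w ~ b → nonEdgeCuts w r ⊆ᴸ acc →
                      ∀ {t'} → t' ⊆ᴸ w ∷ r → t' ⊈ t → ∃[ y ] (y ∈ t' × y ∉ t × Any (_⊆ᴸ y ∷ t) acc)
      edge-exchange a~b w≁a w≁b nonEdgeCuts⊆acc t'⊆w∷r t'⊈t with find t'⊈t
      ... | y , y∈t' , y∉t = y , y∈t' , y∉t , exchange-for (adj? a y) (adj? b y)
        where
        y∈r : y ∈ r
        y∈r = in-r t'⊆w∷r (here refl) y∈t' y∉t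

        wXY-exchange : ∀ {x} → x ∈ r → x ≢ y → NonEdgeCut w (x , y) → triple w (x , y) ⊆ᴸ y ∷ t →
                       Any (_⊆ᴸ y ∷ t) acc
        wXY-exchange x∈r x≢y cut wxy⊆ =
          let s , s∈ , s↭ = ∈-nonEdgeCuts-↭ x∈r y∈r x≢y cut
          in lose (nonEdgeCuts⊆acc s∈) (wxy⊆ ∘ ∈-resp-↭ s↭)

        exchange-for : Dec (a ~ y) → Dec (b ~ y) → Any (_⊆ᴸ y ∷ t) acc
        exchange-for (yes a~y) _ =
          wXY-exchange b∈r (λ { refl → y∉t (there (there (here refl))) })
            (b≁y , there (here ((w≁b ∘ adj-sym) ∷ ≁-refl ∷ b≁y ∷ [])))
            λ { (here refl) → there (here refl)
              ; (there (here refl)) → there (there (there (here refl)))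
              ; (there (there (here refl))) → here refl }
          where
          b≁y : ¬ b ~ y
          b≁y = triangle-free (adj-sym a~b) a~y
        exchange-for (no _) (yes b~y) =
          wXY-exchange a∈r (λ { refl → y∉t (there (here refl)) })
            (a≁y , there (here ((w≁a ∘ adj-sym) ∷ ≁-refl ∷ a≁y ∷ [])))
            λ { (here refl) → there (here refl)
              ; (there (here refl)) → there (there (here refl))
              ; (there (there (here refl))) → here refl }
          where
          a≁y : ¬ a ~ y
          a≁y a~y = triangle-free a~b b~y a~y
        exchange-for (no a≁y) (no b≁y) =
          abY-exchange y∈r y∉t (there (there (here ((a≁y ∘ adj-sym) ∷ (b≁y ∘ adj-sym) ∷ ≁-refl ∷ []))))

    private
      ≢w : ∀ {v} → v ∈ r → v ≢ w
      ≢w v∈r refl = w∉r v∈r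

      block-⊆ : ∀ {t} {P : Vertex × Vertex → Set} (P? : ∀ p → Dec (P p)) →
                (∀ {p} → P p → HasIsolated (triple w p)) → t ∈ block w P? r → t ⊆ᴸ w ∷ r
      block-⊆ P? P⇒iso t∈ = proj₁ (proj₂ (proj₂ (block-cutTriple P? P⇒iso w∉r r-unique t∈)))

      earlier-cutTriple : ∀ {t' a b} → t' ∈ cutTriples r → t' ⊆ᴸ w ∷ r × t' ⊈ triple w (a , b)
      earlier-cutTriple t'∈ =
        let cut = cutTriples-sound r-unique t'∈ in there ∘ proj₁ (proj₂ (proj₂ cut)) , cutTriple-⊈ w∉r cut

    nonEdge-step : ∀ {pre t} → All (_∈ nonEdgeCuts w r) pre → t ∈ nonEdgeCuts w r → All (_⊈ t) pre →
                   Exchange (cutTriples r ++ pre) t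
    nonEdge-step {pre} pre∈ t∈ pre⊈t {t'} t'∈ with ∈-block⁻ w (nonEdgeCut? w) r t∈
    ... | (a , b) , ab∈ , (a≁b , _) , refl =
      let a∈r , b∈r , a≢b = pairs-sound r-unique ab∈ ; t'⊆ , t'⊈ = earlier (∈-++⁻ (cutTriples r) t'∈) in
      nonEdge-exchange a∈r b∈r a≢b ∈-++⁺ˡ a≁b t'∈ t'⊆ t'⊈
      where
      earlier : t' ∈ cutTriples r ⊎ t' ∈ pre → t' ⊆ᴸ w ∷ r × t' ⊈ triple w (a , b)
      earlier (inj₁ t'∈r) = earlier-cutTriple t'∈r
      earlier (inj₂ t'∈pre) =
        block-⊆ {P = NonEdgeCut w} (nonEdgeCut? w) proj₂ (All.lookup pre∈ t'∈pre) , All.lookup pre⊈t t'∈pre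

    edge-step : ∀ {pre t} → All (_∈ edgeCuts w r) pre → t ∈ edgeCuts w r → All (_⊈ t) pre →
                Exchange ((cutTriples r ++ nonEdgeCuts w r) ++ pre) t
    edge-step {pre} pre∈ t∈ pre⊈t {t'} t'∈ with ∈-block⁻ w (edgeCut? w) r t∈
    ... | (a , b) , ab∈ , (a~b , iso) , refl =
      let a∈r , b∈r , a≢b = pairs-sound r-unique ab∈ ; w≁a , w≁b = apex-isolated a~b iso
          t'⊆ , t'⊈ = earlier (∈-++⁻ (cutTriples r ++ nonEdgeCuts w r) t'∈) in
      edge-exchange a∈r b∈r a≢b (∈-++⁺ˡ ∘ ∈-++⁺ˡ) a~b w≁a w≁b (∈-++⁺ˡ ∘ ∈-++⁺ʳ (cutTriples r))
        t'⊆ t'⊈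
      where
      earlier : t' ∈ cutTriples r ++ nonEdgeCuts w r ⊎ t' ∈ pre → t' ⊆ᴸ w ∷ r × t' ⊈ triple w (a , b)
      earlier (inj₂ t'∈pre) =
        block-⊆ {P = EdgeCut w} (edgeCut? w) proj₂ (All.lookup pre∈ t'∈pre) , All.lookup pre⊈t t'∈pre
      earlier (inj₁ t'∈base) with ∈-++⁻ (cutTriples r) t'∈base
      ... | inj₁ t'∈r = earlier-cutTriple t'∈r
      ... | inj₂ t'∈ne with ∈-block⁻ w (nonEdgeCut? w) r t'∈ne
      ...   | (c , d) , cd∈ , (c≁d , _) , refl =
        let c∈r , d∈r , c≢d = pairs-sound r-unique cd∈ in
        block-⊆ {P = NonEdgeCut w} (nonEdgeCut? w) proj₂ t'∈ne ,
        nonEdge-⊈-edge (≢w c∈r) (≢w d∈r) c≢d c≁d a~b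

  cutTriples-incremental : ∀ {vs} → Unique vs → Incremental Exchange [] (cutTriples vs)
  cutTriples-incremental {[]} _ = tt
  cutTriples-incremental {w ∷ r} (w≢r ∷ r-unique) =
    Incremental-++ [] (cutTriples r) (cutTriples-incremental r-unique)
      (Incremental-++ (cutTriples r) (nonEdgeCuts w r)
        (Incremental-block (cutTriples r) (nonEdge-step w∉r r-unique)
          (block-apart w (nonEdgeCut? w) w∉r r-unique) (All.tabulate id))
        (Incremental-block (cutTriples r ++ nonEdgeCuts w r) (edge-step w∉r r-unique)
          (block-apart w (edgeCut? w) w∉r r-unique) (All.tabulate id)))
    where
    w∉r : w ∉ r
    w∉r = All.All¬⇒¬Any w≢r

  exchange⇒step : ∀ {acc t} → Exchange acc t → ShellingStep (map outside acc) (outside t)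
  exchange⇒step {acc} {t} exchange F'∈ with ∈-map⁻ outside F'∈
  ... | t' , t'∈ , refl with exchange t'∈
  ... | y , y∈t' , y∉t , t''⊆y∷t =
    y , ∉⇒outside y∉t , (λ out → outside⇒∉ out y∈t') , Any.map⁺ (Any.map ridge⊆ t''⊆y∷t)
    where
    ridge⊆ : ∀ {t''} → t'' ⊆ᴸ y ∷ t → outside t ─ y ⊆ outside t''
    ridge⊆ {t''} t''⊆y∷t v ridge-v = ∉⇒outside v∉t''
      where
      v∉t'' : v ∉ t''
      v∉t'' v∈t'' with ─⁻ {outside t} ridge-v | t''⊆y∷t v∈t''
      ... | _ , v≢y | here v≡y = v≢y v≡y
      ... | out , _ | there v∈t = outside⇒∉ out v∈t

  ≗-outside : ∀ {σ t} → (∀ v → T (compl σ v) → v ∈ t) → (∀ v → v ∈ t → T (compl σ v)) →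
              ∀ v → σ v ≡ outside t v
  ≗-outside {σ} {t} σ⇒∈ ∈⇒σ v with σ v | σ⇒∈ v | ∈⇒σ v | v ∈? t
  ... | true  | _     | ∈⇒σv | yes v∈t = ⊥-elim (∈⇒σv v∈t)
  ... | true  | _     | _    | no _ = refl
  ... | false | _     | _    | yes _ = refl
  ... | false | σv⇒∈ | _    | no v∉t = ⊥-elim (v∉t (σv⇒∈ _))

  Δ₃-shellable : ∀ vs → Unique vs → (∀ v → v ∈ vs) → Shellable (CutFacet G 3)
  Δ₃-shellable vs vs-unique vs-complete =
    shellable-bySteps (map outside (cutTriples vs)) facets covers
      (Incremental-map outside exchange⇒step (cutTriples vs) (cutTriples-incremental vs-unique))
    where
    facets : All (CutFacet G 3) (map outside (cutTriples vs))
    facets = All.map⁺ (All.tabulate λ {t} t∈ →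
      let t-unique , |t|≡3 , _ , iso = cutTriples-sound vs-unique t∈ in
      subst (λ k → CutFacet G k (outside t)) |t|≡3
        (outside-cutFacet t-unique (subst (2 ≤_) (sym |t|≡3) (s≤s (s≤s z≤n))) iso))

    covers : ∀ σ → CutFacet G 3 σ → Any (λ F → ∀ v → σ v ≡ F v) (map outside (cutTriples vs))
    covers σ ((xs , xs-unique , |xs|≡3 , σ⇒∈ , ∈⇒σ) , disconnected) with hasIsolated? xs
    ... | no no-isolated = ⊥-elim (disconnected (connected-unless-isolated |xs|≡3 σ⇒∈ ∈⇒σ no-isolated))
    ... | yes iso =
      let t , t∈ , t↭xs = cutTriples-complete vs-unique (xs-unique , |xs|≡3 , (λ _ → vs-complete _) , iso) in
      Any.map⁺ (lose t∈ (≗-outside (λ v → ∈-resp-↭ (↭-sym t↭xs) ∘ σ⇒∈ v)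
                                   (λ v → ∈⇒σ v ∘ ∈-resp-↭ t↭xs)))

-- An indexed view of membership in triCenters: matching on it lets the coverage checker
-- discard the impossible cases.
infix 4 _∈△_
data _∈△_ : Center → Triangle → Set where
  u₀ : ∀ {p q} → (p , q) ∈△ (false , p , q)
  u₁ : ∀ {p q} → (suc p , q) ∈△ (false , p , q)
  u₂ : ∀ {p q} → (p , suc q) ∈△ (false , p , q)
  d₀ : ∀ {p q} → (suc p , q) ∈△ (true , p , q)
  d₁ : ∀ {p q} → (p , suc q) ∈△ (true , p , q)
  d₂ : ∀ {p q} → (suc p , suc q) ∈△ (true , p , q)

∈triCenters⇒∈△ : ∀ {h} t → h ∈ triCenters t → h ∈△ t
∈triCenters⇒∈△ (false , _) (here refl) = u₀
∈triCenters⇒∈△ (false , _) (there (here refl)) = u₁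
∈triCenters⇒∈△ (false , _) (there (there (here refl))) = u₂
∈triCenters⇒∈△ (true , _) (here refl) = d₀
∈triCenters⇒∈△ (true , _) (there (here refl)) = d₁
∈triCenters⇒∈△ (true , _) (there (there (here refl))) = d₂

anchor-≤ : ∀ {a b o p q} → (a , b) ∈△ (o , p , q) → p ≤ a × q ≤ b
anchor-≤ u₀ = ℕ.≤-refl , ℕ.≤-refl
anchor-≤ u₁ = ℕ.n≤1+n _ , ℕ.≤-refl
anchor-≤ u₂ = ℕ.≤-refl , ℕ.n≤1+n _
anchor-≤ d₀ = ℕ.n≤1+n _ , ℕ.≤-refl
anchor-≤ d₁ = ℕ.≤-refl , ℕ.n≤1+n _
anchor-≤ d₂ = ℕ.n≤1+n _ , ℕ.n≤1+n _

data Side : Triangle → Triangle → Set where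
  ↑↓₀ : ∀ {p q} → Side (false , p , q) (true , p , q)
  ↑↓₁ : ∀ {p q} → Side (false , p , suc q) (true , p , q)
  ↑↓₂ : ∀ {p q} → Side (false , suc p , q) (true , p , q)
  ↓↑₀ : ∀ {p q} → Side (true , p , q) (false , p , q)
  ↓↑₁ : ∀ {p q} → Side (true , p , q) (false , p , suc q)
  ↓↑₂ : ∀ {p q} → Side (true , p , q) (false , suc p , q)

shared-pair⇒Side : ∀ {x y h c} → x ≢ y → h ≢ c → h ∈△ x → c ∈△ x → h ∈△ y → c ∈△ y → Side x y
shared-pair⇒Side _ h≢c u₀ u₀ _ _ = ⊥-elim (h≢c refl)
shared-pair⇒Side _ h≢c u₁ u₁ _ _ = ⊥-elim (h≢c refl)
shared-pair⇒Side _ h≢c u₂ u₂ _ _ = ⊥-elim (h≢c refl)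
shared-pair⇒Side _ h≢c d₀ d₀ _ _ = ⊥-elim (h≢c refl)
shared-pair⇒Side _ h≢c d₁ d₁ _ _ = ⊥-elim (h≢c refl)
shared-pair⇒Side _ h≢c d₂ d₂ _ _ = ⊥-elim (h≢c refl)
shared-pair⇒Side _ _ u₁ u₂ d₀ d₁ = ↑↓₀
shared-pair⇒Side _ _ u₂ u₁ d₁ d₀ = ↑↓₀
shared-pair⇒Side _ _ u₀ u₁ d₁ d₂ = ↑↓₁
shared-pair⇒Side _ _ u₁ u₀ d₂ d₁ = ↑↓₁
shared-pair⇒Side _ _ u₀ u₂ d₀ d₂ = ↑↓₂
shared-pair⇒Side _ _ u₂ u₀ d₂ d₀ = ↑↓₂
shared-pair⇒Side _ _ d₀ d₁ u₁ u₂ = ↓↑₀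
shared-pair⇒Side _ _ d₁ d₀ u₂ u₁ = ↓↑₀
shared-pair⇒Side _ _ d₁ d₂ u₀ u₁ = ↓↑₁
shared-pair⇒Side _ _ d₂ d₁ u₁ u₀ = ↓↑₁
shared-pair⇒Side _ _ d₀ d₂ u₀ u₂ = ↓↑₂
shared-pair⇒Side _ _ d₂ d₀ u₂ u₀ = ↓↑₂
shared-pair⇒Side x≢y _ u₀ u₁ u₀ u₁ = ⊥-elim (x≢y refl)
shared-pair⇒Side x≢y _ u₁ u₀ u₁ u₀ = ⊥-elim (x≢y refl)
shared-pair⇒Side x≢y _ u₀ u₂ u₀ u₂ = ⊥-elim (x≢y refl)
shared-pair⇒Side x≢y _ u₂ u₀ u₂ u₀ = ⊥-elim (x≢y refl)
shared-pair⇒Side x≢y _ u₁ u₂ u₁ u₂ = ⊥-elim (x≢y refl)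
shared-pair⇒Side x≢y _ u₂ u₁ u₂ u₁ = ⊥-elim (x≢y refl)
shared-pair⇒Side x≢y _ d₀ d₁ d₀ d₁ = ⊥-elim (x≢y refl)
shared-pair⇒Side x≢y _ d₁ d₀ d₁ d₀ = ⊥-elim (x≢y refl)
shared-pair⇒Side x≢y _ d₀ d₂ d₀ d₂ = ⊥-elim (x≢y refl)
shared-pair⇒Side x≢y _ d₂ d₀ d₂ d₀ = ⊥-elim (x≢y refl)
shared-pair⇒Side x≢y _ d₁ d₂ d₁ d₂ = ⊥-elim (x≢y refl)
shared-pair⇒Side x≢y _ d₂ d₁ d₂ d₁ = ⊥-elim (x≢y refl)

Side-flips : ∀ {x y} → Side x y → proj₁ y ≡ not (proj₁ x)
Side-flips ↑↓₀ = refl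
Side-flips ↑↓₁ = refl
Side-flips ↑↓₂ = refl
Side-flips ↓↑₀ = refl
Side-flips ↓↑₁ = refl
Side-flips ↓↑₂ = refl

Side-triangle-free : ∀ {x y z} → Side x y → Side y z → Side x z → ⊥
Side-triangle-free {x} {y} {z} xy yz xz = not-¬ refl (begin
  proj₁ x             ≡⟨ sym (not-involutive (proj₁ x)) ⟩
  not (not (proj₁ x)) ≡⟨ cong not (sym (Side-flips xy)) ⟩
  not (proj₁ y)       ≡⟨ sym (Side-flips yz) ⟩
  proj₁ z             ≡⟨ Side-flips xz ⟩
  not (proj₁ x)       ∎)
  where open ≡-Reasoning

Side-square-free : ∀ {a b y y'} → a ≢ b → Side a y → Side b y → Side a y' → Side b y' → y ≡ y'
Side-square-free a≢b ↑↓₀ ↑↓₀ _ _ = ⊥-elim (a≢b refl)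
Side-square-free a≢b ↑↓₁ ↑↓₁ _ _ = ⊥-elim (a≢b refl)
Side-square-free a≢b ↑↓₂ ↑↓₂ _ _ = ⊥-elim (a≢b refl)
Side-square-free a≢b ↓↑₀ ↓↑₀ _ _ = ⊥-elim (a≢b refl)
Side-square-free a≢b ↓↑₁ ↓↑₁ _ _ = ⊥-elim (a≢b refl)
Side-square-free a≢b ↓↑₂ ↓↑₂ _ _ = ⊥-elim (a≢b refl)
Side-square-free _ ↑↓₀ ↑↓₁ ↑↓₀ ↑↓₁ = refl
Side-square-free _ ↑↓₀ ↑↓₂ ↑↓₀ ↑↓₂ = refl
Side-square-free _ ↑↓₁ ↑↓₀ ↑↓₁ ↑↓₀ = refl
Side-square-free _ ↑↓₁ ↑↓₂ ↑↓₁ ↑↓₂ = refl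
Side-square-free _ ↑↓₂ ↑↓₀ ↑↓₂ ↑↓₀ = refl
Side-square-free _ ↑↓₂ ↑↓₁ ↑↓₂ ↑↓₁ = refl
Side-square-free _ ↓↑₀ ↓↑₁ ↓↑₀ ↓↑₁ = refl
Side-square-free _ ↓↑₀ ↓↑₂ ↓↑₀ ↓↑₂ = refl
Side-square-free _ ↓↑₁ ↓↑₀ ↓↑₁ ↓↑₀ = refl
Side-square-free _ ↓↑₁ ↓↑₂ ↓↑₁ ↓↑₂ = refl
Side-square-free _ ↓↑₂ ↓↑₀ ↓↑₂ ↓↑₀ = refl
Side-square-free _ ↓↑₂ ↓↑₁ ↓↑₂ ↓↑₁ = refl

module _ {A : Set} (P : A → Bool) where

  refine : List A → List (Σ A (T ∘ P))
  refine [] = []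
  refine (x ∷ xs) with T? (P x)
  ... | yes Px = (x , Px) ∷ refine xs
  ... | no _ = refine xs

  Σ-T-≡ : ∀ {x y : Σ A (T ∘ P)} → proj₁ x ≡ proj₁ y → x ≡ y
  Σ-T-≡ {x , Px} {.x , Px'} refl = cong (x ,_) (T-irrelevant Px Px')

  ∈-refine⁻ : ∀ {xs y} → y ∈ refine xs → proj₁ y ∈ xs
  ∈-refine⁻ {x ∷ xs} y∈ with T? (P x)
  ∈-refine⁻ {x ∷ xs} (here refl) | yes _ = here refl
  ∈-refine⁻ {x ∷ xs} (there y∈) | yes _ = there (∈-refine⁻ y∈)
  ∈-refine⁻ {x ∷ xs} y∈ | no _ = there (∈-refine⁻ y∈)

  ∈-refine⁺ : ∀ {xs y} → proj₁ y ∈ xs → y ∈ refine xs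
  ∈-refine⁺ {x ∷ xs} y∈ with T? (P x)
  ∈-refine⁺ {x ∷ xs} (here refl) | yes _ = here (Σ-T-≡ refl)
  ∈-refine⁺ {x ∷ xs} (there y∈) | yes _ = there (∈-refine⁺ y∈)
  ∈-refine⁺ {x ∷ xs} {_ , Py} (here refl) | no ¬Px = ⊥-elim (¬Px Py)
  ∈-refine⁺ {x ∷ xs} (there y∈) | no _ = ∈-refine⁺ y∈

  refine-unique : ∀ {xs} → Unique xs → Unique (refine xs)
  refine-unique {[]} [] = []
  refine-unique {x ∷ xs} (x≢xs ∷ xs-unique) with T? (P x)
  ... | yes _ =
    All.tabulate (λ y∈ x≡y → All.lookup x≢xs (∈-refine⁻ y∈) (cong proj₁ x≡y)) ∷ refine-unique xs-unique
  ... | no _ = refine-unique xs-unique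

inPatch-bounded : ∀ {m n a b} → T (inPatch m n (a , b)) → a ≤ m × b ≤ n
inPatch-bounded {m} {n} {a} {b} in-patch =
  let _ , rest = Equivalence.to (T-∧ {1 ≤ᵇ a}) in-patch
      a≤m , rest = Equivalence.to (T-∧ {a ≤ᵇ m}) rest
      _ , b≤n = Equivalence.to (T-∧ {1 ≤ᵇ b}) rest
  in ℕ.≤ᵇ⇒≤ a m a≤m , ℕ.≤ᵇ⇒≤ b n b≤n

corner-bounded : ∀ {m n o p q} → T (isCorner m n (o , p , q)) → p ≤ m × q ≤ n
corner-bounded {m} {n} {o} {p} {q} corner with find (Any.any⁻ (inPatch m n) (triCenters (o , p , q)) corner)
... | (a , b) , h∈ , in-patch =
  let p≤a , q≤b = anchor-≤ (∈triCenters⇒∈△ (o , p , q) h∈) ; a≤m , b≤n = inPatch-bounded in-patch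
  in ℕ.≤-trans p≤a a≤m , ℕ.≤-trans q≤b b≤n

module HexGrid (m n : ℕ) where

  _≟ᵗ_ : DecidableEquality Triangle
  _≟ᵗ_ = ≡-dec Bool._≟_ (≡-dec ℕ._≟_ ℕ._≟_)

  _≟ᶜ_ : DecidableEquality Center
  _≟ᶜ_ = ≡-dec ℕ._≟_ ℕ._≟_

  _≟_ : DecidableEquality (HexV m n)
  (x , _) ≟ (y , _) = map′ (Σ-T-≡ (isCorner m n)) (cong proj₁) (x ≟ᵗ y)

  SharedSide : Triangle → Triangle → Set
  SharedSide x y = Σ Center λ h → Σ Center λ c →
    h ≢ c × T (inPatch m n h) × h ∈ triCenters x × c ∈ triCenters x × h ∈ triCenters y × c ∈ triCenters y

  sharedSide? : ∀ x y → Dec (SharedSide x y)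
  sharedSide? x y = map′ from to (any? (λ h → any? (shared? h) (triCenters x)) (triCenters x))
    where
    open import Data.List.Membership.DecPropositional _≟ᶜ_ using (_∈?_)
    Shared : Center → Center → Set
    Shared h c = h ≢ c × T (inPatch m n h) × h ∈ triCenters y × c ∈ triCenters y
    shared? : ∀ h c → Dec (Shared h c)
    shared? h c = ¬? (h ≟ᶜ c) ×-dec T? (inPatch m n h) ×-dec h ∈? triCenters y ×-dec c ∈? triCenters y
    from : Any (λ h → Any (Shared h) (triCenters x)) (triCenters x) → SharedSide x y
    from any-h with find any-h
    ... | h , h∈x , any-c with find any-c
    ...   | c , c∈x , h≢c , in-patch , h∈y , c∈y = h , c , h≢c , in-patch , h∈x , c∈x , h∈y , c∈y
    to : SharedSide x y → Any (λ h → Any (Shared h) (triCenters x)) (triCenters x)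
    to (h , c , h≢c , in-patch , h∈x , c∈x , h∈y , c∈y) = lose h∈x (lose c∈x (h≢c , in-patch , h∈y , c∈y))

  adj? : ∀ x y → Dec (HexAdj m n x y)
  adj? (x , _) (y , _) = ¬? (x ≟ᵗ y) ×-dec sharedSide? x y

  adj-sym : ∀ {x y} → HexAdj m n x y → HexAdj m n y x
  adj-sym (x≢y , h , c , h≢c , in-patch , h∈x , c∈x , h∈y , c∈y) =
    x≢y ∘ sym , h , c , h≢c , in-patch , h∈y , c∈y , h∈x , c∈x

  adj-irrefl : ∀ {x y} → HexAdj m n x y → x ≢ y
  adj-irrefl (x≢y , _) = x≢y ∘ cong proj₁

  adj⇒Side : ∀ {x y} → HexAdj m n x y → Side (proj₁ x) (proj₁ y)
  adj⇒Side {x , _} {y , _} (x≢y , h , c , h≢c , _ , h∈x , c∈x , h∈y , c∈y) =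
    shared-pair⇒Side x≢y h≢c (∈triCenters⇒∈△ x h∈x) (∈triCenters⇒∈△ x c∈x)
                             (∈triCenters⇒∈△ y h∈y) (∈triCenters⇒∈△ y c∈y)

  triangle-free : ∀ {x y z} → HexAdj m n x y → HexAdj m n y z → HexAdj m n x z → ⊥
  triangle-free {x} {y} {z} xy yz xz =
    Side-triangle-free (adj⇒Side {x} {y} xy) (adj⇒Side {y} {z} yz) (adj⇒Side {x} {z} xz)

  square-free : ∀ {a b y y'} → a ≢ b →
                HexAdj m n a y → HexAdj m n b y → HexAdj m n a y' → HexAdj m n b y' → y ≡ y'
  square-free {a} {b} {y} {y'} a≢b ay by ay' by' =
    Σ-T-≡ (isCorner m n) (Side-square-free (a≢b ∘ Σ-T-≡ (isCorner m n))
      (adj⇒Side {a} {y} ay) (adj⇒Side {b} {y} by) (adj⇒Side {a} {y'} ay') (adj⇒Side {b} {y'} by'))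

  orientations : List Bool
  orientations = true ∷ false ∷ []

  orientations-unique : Unique orientations
  orientations-unique = ((λ ()) ∷ []) ∷ [] ∷ []

  orientations-complete : ∀ o → o ∈ orientations
  orientations-complete true = here refl
  orientations-complete false = there (here refl)

  triangles : List Triangle
  triangles = cartesianProduct orientations (cartesianProduct (upTo (suc m)) (upTo (suc n)))

  corners : List (HexV m n)
  corners = refine (isCorner m n) triangles

  corners-unique : Unique corners
  corners-unique = refine-unique (isCorner m n)
    (Unique.cartesianProduct⁺ orientations-unique
      (Unique.cartesianProduct⁺ (Unique.upTo⁺ (suc m)) (Unique.upTo⁺ (suc n))))

  corners-complete : ∀ v → v ∈ corners
  corners-complete v@((o , p , q) , corner) =
    let p≤m , q≤n = corner-bounded {o = o} corner in
    ∈-refine⁺ (isCorner m n) {y = v}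
      (∈-cartesianProduct⁺ (orientations-complete o)
        (∈-cartesianProduct⁺ (∈-upTo⁺ (s≤s p≤m)) (∈-upTo⁺ (s≤s q≤n))))

mainTheorem1 : (m n : ℕ) → 1 ≤ m → 1 ≤ n → Shellable (CutFacet (Hex m n) 3)
-- Every patch has girth ≥ 5.
mainTheorem1 m n _ _ =
  GirthFive.Δ₃-shellable (Hex m n) _≟_ adj?
    (λ {x} {y} → adj-sym {x} {y}) (λ {x} {y} → adj-irrefl {x} {y})
    (λ {x} {y} {z} → triangle-free {x} {y} {z}) (λ {a} {b} {y} {y'} → square-free {a} {b} {y} {y'})
    corners corners-unique corners-complete
  where open HexGrid m n
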